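{- Fix $n\geq 4$. Let $L=\{L(v)\}_{v\in V(C_{2n})}$ be an assignment of lists of size $3$ to the vertices of the cycle $C_{2n}$ with $2n$ vertices, such that $\left|\bigcup_{v\in V(C_{2n})}L(v)\right|\neq 3$. Then $C_{2n}$ is properly $L$-distinguishable.
   Context: A vertex coloring $f$ of a graph $G$ is distinguishing if the only automorphism $\phi$ of $G$ with $f(\phi(v))=f(v)$ for all vertices $v$ is the identity. Given a list assignment $L$ (a finite set $L(v)$ of colors for each vertex $v$), $G$ is properly $L$-distinguishable if there is a proper vertex coloring $f$ of $G$ which is distinguishing and satisfies $f(v)\in L(v)$ for all $v$. -}

module Defs where

open import Data.Nat using (ℕ; zero; suc; _≟_)
open import Data.Fin using (Fin; toℕ)
open import Data.List using (List; length; concatMap; allFin; deduplicate)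
open import Data.List.Membership.Propositional using (_∈_)
open import Data.Product using (Σ; _×_; ∃)
open import Data.Sum using (_⊎_)
open import Function.Definitions using (Bijective)
open import Relation.Binary.PropositionalEquality using (_≡_; _≢_)

CycStep : (m : ℕ) → Fin m → Fin m → Set
CycStep m i j = (toℕ j ≡ suc (toℕ i)) ⊎ ((suc (toℕ i) ≡ m) × (toℕ j ≡ 0))

CycleAdj : (m : ℕ) → Fin m → Fin m → Set
CycleAdj m i j = CycStep m i j ⊎ CycStep m j i

IsAutomorphism : {m : ℕ} → (Fin m → Fin m → Set) → (Fin m → Fin m) → Set
IsAutomorphism {m} E φ =
  Bijective _≡_ _≡_ φ × (∀ u v → (E u v → E (φ u) (φ v)) × (E (φ u) (φ v) → E u v))

IsProper : {m : ℕ} → (Fin m → Fin m → Set) → (Fin m → ℕ) → Set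
IsProper {m} E f = ∀ u v → E u v → f u ≢ f v

IsDistinguishing : {m : ℕ} → (Fin m → Fin m → Set) → (Fin m → ℕ) → Set
IsDistinguishing {m} E f =
  ∀ (φ : Fin m → Fin m) → IsAutomorphism E φ → (∀ v → f (φ v) ≡ f v) → ∀ v → φ v ≡ v

ProperlyLDistinguishable : {m : ℕ} → (Fin m → Fin m → Set) → (Fin m → List ℕ) → Set
ProperlyLDistinguishable {m} E L =
  Σ (Fin m → ℕ) λ f → IsProper E f × IsDistinguishing E f × (∀ v → f v ∈ L v)

unionSize : {m : ℕ} → (Fin m → List ℕ) → ℕ
unionSize {m} L = length (deduplicate _≟_ (concatMap L (allFin m)))

{-# OPTIONS --safe #-}

-- The argument works for every cycle C_m with m ≥ 3. Since the lists do not all coincide, some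
-- vertex u has a colour c that is missing from the list of its predecessor. Colour u by c and
-- then walk once around the cycle, u+1, …, u−1, choosing greedily a colour different from the
-- previous one and from c; at the last vertex u−1, which cannot receive c anyway, avoid the
-- colour of u+1 instead. Then c occurs only at u, so every colour-preserving automorphism fixes
-- u; it cannot swap u+1 and u−1, so it fixes u+1 as well, and an automorphism of a cycle fixing
-- two adjacent vertices is the identity.
module Submission where

open import Defs
open import Data.Nat using (ℕ; NonZero; zero; suc; _+_; _*_; _∸_; _≤_; _<_; _≟_; _%_; z≤n; s≤s)
open import Data.Nat.Properties
  using (+-comm; +-assoc; +-suc; +-identityʳ; m+[n∸m]≡n; m∸n+n≡m; m≤n⇒m<n∨m≡n; suc-injective;
         <⇒≤; ≤-refl; ≤-reflexive; ≤-trans; n≤1+n; m≤n*m)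
open import Data.Nat.DivMod using (_mod_; m%n<n; m%n%n≡m%n; %-distribˡ-+; m<n⇒m%n≡m; n%n≡0; [m+n]%n≡m%n)
open import Data.Fin as Fin using (Fin; toℕ)
open import Data.Fin.Properties using (toℕ-injective; toℕ-fromℕ<; toℕ<n) renaming (any? to Fin-any?)
open import Data.List using (List; _∷_; length; concatMap; allFin; deduplicate)
open import Data.List.Membership.Propositional using (_∈_; _∉_; lose; find)
open import Data.List.Membership.Propositional.Properties
  using (∈-deduplicate⁻; ∈-deduplicate⁺; ∈-concatMap⁻; ∈-concatMap⁺; ∈-allFin)
open import Data.List.Membership.Propositional.Properties.WithK using (unique∧set⇒bag)
open import Data.List.Membership.DecPropositional _≟_ using (_∈?_)
open import Data.List.Relation.Binary.Subset.Propositional using (_⊆_)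
open import Data.List.Relation.Binary.BagAndSetEquality using (∼bag⇒↭)
open import Data.List.Relation.Binary.Permutation.Propositional.Properties using (↭-length)
open import Data.List.Relation.Unary.All as All using (_∷_)
open import Data.List.Relation.Unary.AllPairs using (_∷_)
open import Data.List.Relation.Unary.Any as Any using (here; there; satisfied)
open import Data.List.Relation.Unary.Unique.Propositional using (Unique)
open import Data.List.Relation.Unary.Unique.DecPropositional.Properties _≟_ using (deduplicate-!)
open import Data.Product using (_×_; _,_; proj₁; proj₂; ∃-syntax)
open import Data.Sum as Sum using (_⊎_; inj₁; inj₂)
open import Data.Empty using (⊥-elim)
open import Function using (_∘_)
open import Function.Bundles using (mk⇔)
open import Relation.Nullary using (yes; no; ¬?)
open import Relation.Nullary.Decidable using (decidable-stable)
open import Relation.Binary.PropositionalEquality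
  using (_≡_; _≢_; refl; sym; trans; cong; subst; ≢-sym; module ≡-Reasoning)

open ≡-Reasoning

∃-≢ : ∀ {xs : List ℕ} → Unique xs → 2 ≤ length xs → ∀ a → ∃[ y ] y ∈ xs × y ≢ a
∃-≢ {x ∷ x′ ∷ _} ((x≢x′ ∷ _) ∷ _) (s≤s (s≤s _)) a with x ≟ a
... | yes refl = x′ , there (here refl) , ≢-sym x≢x′
... | no x≢a   = x , here refl , x≢a

∃-≢-≢ : ∀ {xs : List ℕ} → Unique xs → 3 ≤ length xs → ∀ a b → ∃[ y ] y ∈ xs × y ≢ a × y ≢ b
∃-≢-≢ {x ∷ xs} (x≢xs ∷ xs!) (s≤s 2≤∣xs∣) a b with x ≟ a | x ≟ b
... | no x≢a   | no x≢b = x , here refl , x≢a , x≢b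
... | yes refl | _      = let y , y∈xs , y≢b = ∃-≢ xs! 2≤∣xs∣ b
                          in y , there y∈xs , ≢-sym (All.lookup x≢xs y∈xs) , y≢b
... | no _     | yes refl = let y , y∈xs , y≢a = ∃-≢ xs! 2≤∣xs∣ a
                            in y , there y∈xs , y≢a , ≢-sym (All.lookup x≢xs y∈xs)

unionSize-≡-length : ∀ {m} (L : Fin m → List ℕ) u → Unique (L u) → (∀ v → L v ⊆ L u) →
                     unionSize L ≡ length (L u)
unionSize-≡-length {m} L u L[u]! L⊆L[u] =
  ↭-length (∼bag⇒↭ (unique∧set⇒bag (deduplicate-! colours) L[u]! (mk⇔ to from)))
  where
  colours : List ℕ
  colours = concatMap L (allFin m)

  to : ∀ {x} → x ∈ deduplicate _≟_ colours → x ∈ L u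
  to x∈ = let v , x∈L[v] = satisfied (∈-concatMap⁻ L {xs = allFin m} (∈-deduplicate⁻ _≟_ colours x∈))
          in L⊆L[u] v x∈L[v]

  from : ∀ {x} → x ∈ L u → x ∈ deduplicate _≟_ colours
  from x∈ = ∈-deduplicate⁺ _≟_ (∈-concatMap⁺ L (lose (∈-allFin u) x∈))

[m+n%d]%d≡[m+n]%d : ∀ m n d .{{_ : NonZero d}} → (m + n % d) % d ≡ (m + n) % d
[m+n%d]%d≡[m+n]%d m n d = begin
  (m + n % d) % d            ≡⟨ %-distribˡ-+ m (n % d) d ⟩
  (m % d + n % d % d) % d    ≡⟨ cong (λ r → (m % d + r) % d) (m%n%n≡m%n n d) ⟩
  (m % d + n % d) % d        ≡⟨ %-distribˡ-+ m n d ⟨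
  (m + n) % d                ∎

module _ {k : ℕ} where

  rotate : ℕ → Fin (suc k) → Fin (suc k)
  rotate t v = (t + toℕ v) mod suc k

  prev : Fin (suc k) → Fin (suc k)
  prev = rotate k

  offset : Fin (suc k) → Fin (suc k) → Fin (suc k)
  offset u = rotate (suc k ∸ toℕ u)

  toℕ-rotate : ∀ t v → toℕ (rotate t v) ≡ (t + toℕ v) % suc k
  toℕ-rotate t v = toℕ-fromℕ< (m%n<n (t + toℕ v) (suc k))

  rotate-+ : ∀ s t v → rotate s (rotate t v) ≡ rotate (s + t) v
  rotate-+ s t v = toℕ-injective (begin
    toℕ (rotate s (rotate t v))          ≡⟨ toℕ-rotate s (rotate t v) ⟩
    (s + toℕ (rotate t v)) % suc k       ≡⟨ cong (λ r → (s + r) % suc k) (toℕ-rotate t v) ⟩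
    (s + (t + toℕ v) % suc k) % suc k    ≡⟨ [m+n%d]%d≡[m+n]%d s (t + toℕ v) (suc k) ⟩
    (s + (t + toℕ v)) % suc k            ≡⟨ cong (_% suc k) (+-assoc s t (toℕ v)) ⟨
    (s + t + toℕ v) % suc k              ≡⟨ toℕ-rotate (s + t) v ⟨
    toℕ (rotate (s + t) v)               ∎)

  rotate-comm : ∀ s t v → rotate s (rotate t v) ≡ rotate t (rotate s v)
  rotate-comm s t v = begin
    rotate s (rotate t v)  ≡⟨ rotate-+ s t v ⟩
    rotate (s + t) v       ≡⟨ cong (λ r → rotate r v) (+-comm s t) ⟩
    rotate (t + s) v       ≡⟨ rotate-+ t s v ⟨
    rotate t (rotate s v)  ∎

  rotate-zero : ∀ v → rotate 0 v ≡ v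
  rotate-zero v = toℕ-injective (trans (toℕ-rotate 0 v) (m<n⇒m%n≡m (toℕ<n v)))

  rotate-period : ∀ t v → rotate (suc k + t) v ≡ rotate t v
  rotate-period t v = toℕ-injective (begin
    toℕ (rotate (suc k + t) v)   ≡⟨ toℕ-rotate (suc k + t) v ⟩
    (suc k + t + toℕ v) % suc k  ≡⟨ cong (_% suc k) (+-assoc (suc k) t (toℕ v)) ⟩
    (suc k + (t + toℕ v)) % suc k ≡⟨ cong (_% suc k) (+-comm (suc k) (t + toℕ v)) ⟩
    (t + toℕ v + suc k) % suc k  ≡⟨ [m+n]%n≡m%n (t + toℕ v) (suc k) ⟩
    (t + toℕ v) % suc k          ≡⟨ toℕ-rotate t v ⟨
    toℕ (rotate t v)             ∎)

  rotate-full : ∀ v → rotate (suc k) v ≡ v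
  rotate-full v = begin
    rotate (suc k) v      ≡⟨ cong (λ r → rotate r v) (+-identityʳ (suc k)) ⟨
    rotate (suc k + 0) v  ≡⟨ rotate-period 0 v ⟩
    rotate 0 v            ≡⟨ rotate-zero v ⟩
    v                     ∎

  prev-rotate-suc : ∀ t v → prev (rotate (suc t) v) ≡ rotate t v
  prev-rotate-suc t v = begin
    rotate k (rotate (suc t) v)  ≡⟨ rotate-+ k (suc t) v ⟩
    rotate (k + suc t) v         ≡⟨ cong (λ r → rotate r v) (+-suc k t) ⟩
    rotate (suc k + t) v         ≡⟨ rotate-period t v ⟩
    rotate t v                   ∎

  rotate-offset : ∀ u v → rotate (toℕ (offset u v)) u ≡ v
  rotate-offset u v = begin
    rotate (toℕ (offset u v)) u                  ≡⟨ cong (_mod suc k) (+-comm (toℕ (offset u v)) (toℕ u)) ⟩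
    rotate (toℕ u) (rotate (suc k ∸ toℕ u) v)    ≡⟨ rotate-+ (toℕ u) (suc k ∸ toℕ u) v ⟩
    rotate (toℕ u + (suc k ∸ toℕ u)) v           ≡⟨ cong (λ r → rotate r v) (m+[n∸m]≡n (<⇒≤ (toℕ<n u))) ⟩
    rotate (suc k) v                             ≡⟨ rotate-full v ⟩
    v                                            ∎

  toℕ-offset-self : ∀ u → toℕ (offset u u) ≡ 0
  toℕ-offset-self u = begin
    toℕ (offset u u)                  ≡⟨ toℕ-rotate (suc k ∸ toℕ u) u ⟩
    (suc k ∸ toℕ u + toℕ u) % suc k   ≡⟨ cong (_% suc k) (m∸n+n≡m (<⇒≤ (toℕ<n u))) ⟩
    suc k % suc k                     ≡⟨ n%n≡0 (suc k) ⟩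
    0                                 ∎

  toℕ-offset-rotate : ∀ u t → toℕ (offset u (rotate t u)) ≡ t % suc k
  toℕ-offset-rotate u t = begin
    toℕ (offset u (rotate t u))     ≡⟨ cong toℕ (rotate-comm (suc k ∸ toℕ u) t u) ⟩
    toℕ (rotate t (offset u u))     ≡⟨ toℕ-rotate t (offset u u) ⟩
    (t + toℕ (offset u u)) % suc k  ≡⟨ cong (λ r → (t + r) % suc k) (toℕ-offset-self u) ⟩
    (t + 0) % suc k                 ≡⟨ cong (_% suc k) (+-identityʳ t) ⟩
    t % suc k                       ∎

  rotate-injectiveˡ : ∀ {s t} v → s < suc k → t < suc k → rotate s v ≡ rotate t v → s ≡ t
  rotate-injectiveˡ {s} {t} v s<m t<m eq = begin
    s                            ≡⟨ m<n⇒m%n≡m s<m ⟨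
    s % suc k                    ≡⟨ toℕ-offset-rotate v s ⟨
    toℕ (offset v (rotate s v))  ≡⟨ cong (toℕ ∘ offset v) eq ⟩
    toℕ (offset v (rotate t v))  ≡⟨ toℕ-offset-rotate v t ⟩
    t % suc k                    ≡⟨ m<n⇒m%n≡m t<m ⟩
    t                            ∎

  CycStep-rotate₁ : ∀ v → CycStep (suc k) v (rotate 1 v)
  CycStep-rotate₁ v with m≤n⇒m<n∨m≡n (toℕ<n v)
  ... | inj₁ 1+v<m = inj₁ (trans (toℕ-rotate 1 v) (m<n⇒m%n≡m 1+v<m))
  ... | inj₂ 1+v≡m =
    inj₂ (1+v≡m , trans (toℕ-rotate 1 v) (trans (cong (_% suc k) 1+v≡m) (n%n≡0 (suc k))))

  CycStep⇒≡rotate₁ : ∀ {v w} → CycStep (suc k) v w → w ≡ rotate 1 v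
  CycStep⇒≡rotate₁ {v} {w} step = toℕ-injective (trans (toℕ-step step) (sym (toℕ-rotate 1 v)))
    where
    toℕ-step : CycStep (suc k) v w → toℕ w ≡ suc (toℕ v) % suc k
    toℕ-step (inj₁ w≡1+v)         = trans w≡1+v (sym (m<n⇒m%n≡m (subst (_< suc k) w≡1+v (toℕ<n w))))
    toℕ-step (inj₂ (1+v≡m , w≡0)) = trans w≡0 (sym (trans (cong (_% suc k) 1+v≡m) (n%n≡0 (suc k))))

  rotate-step : ∀ t v → CycStep (suc k) (rotate t v) (rotate (suc t) v)
  rotate-step t v = subst (CycStep (suc k) (rotate t v)) (rotate-+ 1 t v) (CycStep-rotate₁ (rotate t v))

  prev-step : ∀ v → CycStep (suc k) (prev v) v
  prev-step v =
    subst (CycStep (suc k) (prev v)) (trans (rotate-+ 1 k v) (rotate-full v)) (CycStep-rotate₁ (prev v))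

  CycStep-injective : ∀ {a b c} → CycStep (suc k) a c → CycStep (suc k) b c → a ≡ b
  CycStep-injective {a} {b} {c} a→c b→c = begin
    a                 ≡⟨ trans (prev-rotate-suc 0 a) (rotate-zero a) ⟨
    prev (rotate 1 a) ≡⟨ cong prev (trans (sym (CycStep⇒≡rotate₁ a→c)) (CycStep⇒≡rotate₁ b→c)) ⟩
    prev (rotate 1 b) ≡⟨ trans (prev-rotate-suc 0 b) (rotate-zero b) ⟩
    b                 ∎

  CycStep-rotate : ∀ t {a b} → CycStep (suc k) a b → CycStep (suc k) (rotate t a) (rotate t b)
  CycStep-rotate t {a} {b} a→b = subst (CycStep (suc k) (rotate t a)) (begin
    rotate 1 (rotate t a)  ≡⟨ rotate-comm 1 t a ⟩
    rotate t (rotate 1 a)  ≡⟨ cong (rotate t) (CycStep⇒≡rotate₁ a→b) ⟨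
    rotate t b             ∎) (CycStep-rotate₁ (rotate t a))

  CycleAdj-rotate : ∀ t {a b} → CycleAdj (suc k) a b → CycleAdj (suc k) (rotate t a) (rotate t b)
  CycleAdj-rotate t = Sum.map (CycStep-rotate t) (CycStep-rotate t)

  automorphism-moves-successor : ∀ {φ v w} → IsAutomorphism (CycleAdj (suc k)) φ → φ v ≡ v →
                                 CycStep (suc k) v w → φ w ≡ w ⊎ φ w ≡ prev v
  automorphism-moves-successor {φ} {v} {w} (_ , φ-adj) φv≡v v→w
    with subst (λ x → CycleAdj (suc k) x (φ w)) φv≡v (proj₁ (φ-adj v w) (inj₁ v→w))
  ... | inj₁ v→φw = inj₁ (trans (CycStep⇒≡rotate₁ v→φw) (sym (CycStep⇒≡rotate₁ v→w)))
  ... | inj₂ φw→v = inj₂ (CycStep-injective φw→v (prev-step v))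

  ⊆-prev⇒⊆ : (L : Fin (suc k) → List ℕ) → (∀ v → L v ⊆ L (prev v)) → ∀ u v → L v ⊆ L u
  ⊆-prev⇒⊆ L L⊆L∘prev u v x∈ =
    along (toℕ (offset u v)) (subst (λ w → _ ∈ L w) (sym (rotate-offset u v)) x∈)
    where
    along : ∀ t → L (rotate t u) ⊆ L u
    along zero    x∈ = subst (λ w → _ ∈ L w) (rotate-zero u) x∈
    along (suc t) x∈ = along t (subst (λ w → _ ∈ L w) (prev-rotate-suc t u) (L⊆L∘prev _ x∈))

  colour-missing-from-prev : (L : Fin (suc k) → List ℕ) → Unique (L Fin.zero) →
                             unionSize L ≢ length (L Fin.zero) → ∃[ u ] ∃[ c ] c ∈ L u × c ∉ L (prev u)
  colour-missing-from-prev L L[0]! size≢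
    with Fin-any? (λ u → Any.any? (λ c → ¬? (c ∈? L (prev u))) (L u))
  ... | yes (u , missing) = let c , c∈ , c∉ = find missing in u , c , c∈ , c∉
  ... | no none-missing   =
    ⊥-elim (size≢ (unionSize-≡-length L Fin.zero L[0]! (⊆-prev⇒⊆ L L⊆L∘prev Fin.zero)))
    where
    L⊆L∘prev : ∀ v → L v ⊆ L (prev v)
    L⊆L∘prev v c∈ = decidable-stable (_ ∈? L (prev v)) (λ c∉ → none-missing (v , lose c∈ c∉))

  sequence-colouring-proper : (g : ℕ → ℕ) → (∀ t → g t ≢ g (suc t)) → g k ≢ g 0 →
                              IsProper (CycleAdj (suc k)) (g ∘ toℕ)
  sequence-colouring-proper g g-step g-close _ _ = Sum.[ ≢-step , ≢-sym ∘ ≢-step ]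
    where
    ≢-step : ∀ {i j} → CycStep (suc k) i j → g (toℕ i) ≢ g (toℕ j)
    ≢-step {i} (inj₁ j≡1+i) rewrite j≡1+i = g-step (toℕ i)
    ≢-step (inj₂ (1+i≡m , j≡0)) rewrite suc-injective 1+i≡m | j≡0 = g-close

module _ {n : ℕ} where

  rotate-2+-≢ : ∀ t (u : Fin (3 + n)) → rotate (2 + t) u ≢ rotate t u
  rotate-2+-≢ t u eq
    with rotate-injectiveˡ (rotate t u) (s≤s (s≤s (s≤s z≤n))) (s≤s z≤n)
           (trans (rotate-+ 2 t u) (trans eq (sym (rotate-zero (rotate t u)))))
  ... | ()

  fixes-successor⇒identity : ∀ {φ} {u : Fin (3 + n)} → IsAutomorphism (CycleAdj (3 + n)) φ →
                             φ u ≡ u → φ (rotate 1 u) ≡ rotate 1 u → ∀ v → φ v ≡ v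
  fixes-successor⇒identity {φ} {u} aut@((φ-injective , _) , _) φu≡u φu₁≡u₁ v =
    subst (λ w → φ w ≡ w) (rotate-offset u v) (proj₁ (fixed (toℕ (offset u v))))
    where
    fixed : ∀ t → φ (rotate t u) ≡ rotate t u × φ (rotate (suc t) u) ≡ rotate (suc t) u
    fixed zero    = trans (cong φ (rotate-zero u)) (trans φu≡u (sym (rotate-zero u))) , φu₁≡u₁
    fixed (suc t) with fixed t
    ... | φt≡t , φt₁≡t₁ with automorphism-moves-successor aut φt₁≡t₁ (rotate-step (suc t) u)
    ...   | inj₁ φt₂≡t₂ = φt₁≡t₁ , φt₂≡t₂
    ...   | inj₂ φt₂≡t  =
      ⊥-elim (rotate-2+-≢ t u (φ-injective (trans φt₂≡t (trans (prev-rotate-suc t u) (sym φt≡t)))))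

  unique-colour⇒distinguishing : (f : Fin (3 + n) → ℕ) (u : Fin (3 + n)) →
                                 (∀ w → f w ≡ f u → w ≡ u) → f (rotate 1 u) ≢ f (prev u) →
                                 IsDistinguishing (CycleAdj (3 + n)) f
  unique-colour⇒distinguishing f u only-u f[u₁]≢f[prev-u] φ aut f∘φ≡f =
    fixes-successor⇒identity aut φu≡u φu₁≡u₁
    where
    φu≡u : φ u ≡ u
    φu≡u = only-u (φ u) (f∘φ≡f u)

    φu₁≡u₁ : φ (rotate 1 u) ≡ rotate 1 u
    φu₁≡u₁ with automorphism-moves-successor aut φu≡u (CycStep-rotate₁ u)
    ... | inj₁ φu₁≡u₁ = φu₁≡u₁
    ... | inj₂ φu₁≡prev-u =
      ⊥-elim (f[u₁]≢f[prev-u] (trans (sym (f∘φ≡f (rotate 1 u))) (cong f φu₁≡prev-u)))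

module GreedyWalk (Λ : ℕ → List ℕ) (avoid : ∀ t a b → ∃[ y ] y ∈ Λ t × y ≢ a × y ≢ b)
                  (n c : ℕ) (c∈Λ₀ : c ∈ Λ 0) (c∉Λ-last : c ∉ Λ (2 + n)) where

  extend : ∀ t (a b : ℕ) → ∃[ y ] (y ∈ Λ t × y ≢ a × y ≢ c) × (t ≡ 2 + n → y ≢ b)
  extend t a b with t ≟ 2 + n
  ... | yes refl = let y , y∈ , y≢a , y≢b = avoid t a b
                   in y , (y∈ , y≢a , λ y≡c → c∉Λ-last (subst (_∈ Λ t) y≡c y∈)) , λ _ → y≢b
  ... | no t≢last = let y , y∈ , y≢a , y≢c = avoid t a c
                    in y , (y∈ , y≢a , y≢c) , λ t≡last → ⊥-elim (t≢last t≡last)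

  colour : ℕ → ℕ
  colour zero          = c
  colour (suc zero)    = proj₁ (extend 1 c c)
  colour (suc (suc t)) = proj₁ (extend (2 + t) (colour (suc t)) (colour 1))

  colour-suc : ∀ t → colour (suc t) ∈ Λ (suc t) × colour (suc t) ≢ colour t × colour (suc t) ≢ c
  colour-suc zero    = proj₁ (proj₂ (extend 1 c c))
  colour-suc (suc t) = proj₁ (proj₂ (extend (2 + t) (colour (suc t)) (colour 1)))

  colour-∈ : ∀ t → colour t ∈ Λ t
  colour-∈ zero    = c∈Λ₀
  colour-∈ (suc t) = proj₁ (colour-suc t)

  colour-≢-suc : ∀ t → colour t ≢ colour (suc t)
  colour-≢-suc t = ≢-sym (proj₁ (proj₂ (colour-suc t)))

  colour-suc-≢-c : ∀ t → colour (suc t) ≢ c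
  colour-suc-≢-c t = proj₂ (proj₂ (colour-suc t))

  colour≡c⇒≡0 : ∀ t → colour t ≡ c → t ≡ 0
  colour≡c⇒≡0 zero    _ = refl
  colour≡c⇒≡0 (suc t) e = ⊥-elim (colour-suc-≢-c t e)

  colour-1≢colour-last : colour 1 ≢ colour (2 + n)
  colour-1≢colour-last = ≢-sym (proj₂ (proj₂ (extend (2 + n) (colour (suc n)) (colour 1))) refl)

missing-colour⇒properly-L-distinguishable :
  ∀ {n} (L : Fin (3 + n) → List ℕ) → (∀ v a b → ∃[ y ] y ∈ L v × y ≢ a × y ≢ b) →
  ∀ {u c} → c ∈ L u → c ∉ L (prev u) → ProperlyLDistinguishable (CycleAdj (3 + n)) L
missing-colour⇒properly-L-distinguishable {n} L avoid {u} {c} c∈L[u] c∉L[prev-u] =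
  f , proper , distinguishing , f∈L
  where
  open GreedyWalk (λ t → L (rotate t u)) (λ t → avoid (rotate t u))
                  n c (subst (λ w → c ∈ L w) (sym (rotate-zero u)) c∈L[u]) c∉L[prev-u]

  f : Fin (3 + n) → ℕ
  f v = colour (toℕ (offset u v))

  f∘rotate : ∀ t → t < 3 + n → f (rotate t u) ≡ colour t
  f∘rotate t t<m = cong colour (trans (toℕ-offset-rotate u t) (m<n⇒m%n≡m t<m))

  proper : IsProper (CycleAdj (3 + n)) f
  proper a b a~b = sequence-colouring-proper colour colour-≢-suc (colour-suc-≢-c (suc n))
                      (offset u a) (offset u b) (CycleAdj-rotate (3 + n ∸ toℕ u) a~b)

  only-u : ∀ w → f w ≡ f u → w ≡ u
  only-u w f[w]≡f[u] = begin
    w                            ≡⟨ rotate-offset u w ⟨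
    rotate (toℕ (offset u w)) u  ≡⟨ cong (λ t → rotate t u) (colour≡c⇒≡0 (toℕ (offset u w)) f[w]≡c) ⟩
    rotate 0 u                   ≡⟨ rotate-zero u ⟩
    u                            ∎
    where
    f[w]≡c : f w ≡ c
    f[w]≡c = trans f[w]≡f[u] (cong colour (toℕ-offset-self u))

  distinguishing : IsDistinguishing (CycleAdj (3 + n)) f
  distinguishing = unique-colour⇒distinguishing f u only-u (λ eq →
    colour-1≢colour-last (trans (sym (f∘rotate 1 (s≤s (s≤s z≤n)))) (trans eq (f∘rotate (2 + n) ≤-refl))))

  f∈L : ∀ v → f v ∈ L v
  f∈L v = subst (λ w → f v ∈ L w) (rotate-offset u v) (colour-∈ (toℕ (offset u v)))

cycle-properly-L-distinguishable : ∀ {m} → 3 ≤ m → (L : Fin m → List ℕ) →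
  (∀ v → Unique (L v) × length (L v) ≡ 3) → unionSize L ≢ 3 → ProperlyLDistinguishable (CycleAdj m) L
cycle-properly-L-distinguishable (s≤s (s≤s (s≤s _))) L L-3 unionSize≢3 =
  let u , c , c∈L[u] , c∉L[prev-u] = colour-missing-from-prev L (proj₁ (L-3 Fin.zero))
                                       (λ eq → unionSize≢3 (trans eq (proj₂ (L-3 Fin.zero))))
  in missing-colour⇒properly-L-distinguishable L avoid c∈L[u] c∉L[prev-u]
  where
  avoid : ∀ v a b → ∃[ y ] y ∈ L v × y ≢ a × y ≢ b
  avoid v = ∃-≢-≢ (proj₁ (L-3 v)) (≤-reflexive (sym (proj₂ (L-3 v))))

proposition2p5 : (n : ℕ) → 4 ≤ n → (L : Fin (2 * n) → List ℕ) →
    (∀ v → Unique (L v) × length (L v) ≡ 3) →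
    unionSize L ≢ 3 →
    ProperlyLDistinguishable (CycleAdj (2 * n)) L
proposition2p5 n 4≤n = cycle-properly-L-distinguishable (≤-trans (n≤1+n 3) (≤-trans 4≤n (m≤n*m n 2)))
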